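{- Let $q$ be a prime power and $e,d$ integers with $e>d>0$. Let $g\in\mathbb{F}_q[T]$ be monic of degree $e$, $g^*$ its square-free part and $(\lambda_1^*,\ldots,\lambda_e^*)$ the factorization pattern of $g^*$. Let $k$ be the least integer with $\lambda_k^*>0$. For $0\le j\le d$ let $B_j$ be the set of monic $f\in\mathbb{F}_q[T]$ of degree $d$ with $\deg\gcd(g,f)=j$. If $k\le d$, then $$\lambda_k^*\,q^{d-k}-\binom{\lambda_k^*}{2}q^{\max\{d-2k,0\}}\le\left|\bigcup_{j=1}^dB_j\right|\le\lambda_k^*\,q^{d-k}+\sum_{i=k+1}^d\lambda_i^*\,q^{d-i}.$$
   Context: The square-free part $g^*$ of $g$ is the product of the distinct monic irreducible factors of $g$. The factorization pattern $(\lambda_1^*,\ldots,\lambda_e^*)$ of $g^*$ means $\lambda_i^*$ is the number of monic irreducible factors of $g^*$ of degree $i$ (the number of distinct monic irreducible factors of $g$ of degree $i$). -}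

module Defs where

open import Level using (0ℓ)
open import Data.Nat using (ℕ; zero; suc; _∸_; _≤_) renaming (_+_ to _+ℕ_)
open import Data.Fin using (Fin)
open import Data.Nat.ListAction using (sum)
open import Data.List using (List; []; _∷_; map; upTo; length; _++_; [_])
open import Data.Vec using (Vec; toList)
open import Data.Product using (Σ; _×_; ∃)
open import Data.Sum using (_⊎_)
open import Data.List.Membership.Propositional using (_∈_)
open import Data.List.Relation.Unary.Unique.Propositional using (Unique)
open import Relation.Binary.PropositionalEquality using (_≡_)
open import Relation.Nullary using (¬_)
open import Function.Bundles using (_↔_; _⇔_)
open import Algebra.Structures using (IsCommutativeRing)

record FiniteField (q : ℕ) : Set₁ where
  infixl 7 _*_
  infixl 6 _+_
  field
    Carrier : Set
    _+_ _*_ : Carrier → Carrier → Carrier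
    -_      : Carrier → Carrier
    0# 1#   : Carrier
    isCommutativeRing : IsCommutativeRing _≡_ _+_ _*_ -_ 0# 1#
    0≢1     : ¬ (0# ≡ 1#)
    inverse : ∀ x → ¬ (x ≡ 0#) → Σ Carrier (λ y → x * y ≡ 1#)
    finite  : Carrier ↔ Fin q

module Polynomials {q : ℕ} (F : FiniteField q) where
  open FiniteField F

  -- Polynomials as coefficient lists, lowest degree first.
  Poly : Set
  Poly = List Carrier

  _+ₚ_ : Poly → Poly → Poly
  [] +ₚ p = p
  (a ∷ p) +ₚ [] = a ∷ p
  (a ∷ p) +ₚ (b ∷ r) = (a + b) ∷ (p +ₚ r)

  _*ₚ_ : Poly → Poly → Poly
  [] *ₚ r = []
  (a ∷ p) *ₚ r = map (a *_) r +ₚ (0# ∷ (p *ₚ r))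

  -- A monic polynomial of degree n, T^n + c_{n-1} T^{n-1} + ... + c_0,
  -- is represented by its lower coefficients (c_0, ..., c_{n-1}).
  Monic : ℕ → Set
  Monic n = Vec Carrier n

  toPoly : ∀ {n} → Monic n → Poly
  toPoly c = toList c ++ [ 1# ]

  -- h divides g (for monic g, any cofactor is monic).
  _∣ₘ_ : ∀ {j e} → Monic j → Monic e → Set
  _∣ₘ_ {j} {e} h g = Σ ℕ λ m → Σ (Monic m) λ c → (toPoly h *ₚ toPoly c) ≡ toPoly g

  Irreducible : ∀ {i} → Monic i → Set
  Irreducible {i} h = (1 ≤ i) × (∀ j (c : Monic j) → c ∣ₘ h → (j ≡ 0) ⊎ (j ≡ i))

  IsGCD : ∀ {j e d} → Monic j → Monic e → Monic d → Set
  IsGCD h g f = (h ∣ₘ g) × (h ∣ₘ f) ×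
    (∀ m (c : Monic m) → c ∣ₘ g → c ∣ₘ f → c ∣ₘ h)

  DegGCD : ∀ {e d} → Monic e → Monic d → ℕ → Set
  DegGCD g f j = Σ (Monic j) λ h → IsGCD h g f

  B : ∀ {e} (g : Monic e) (d j : ℕ) → Monic d → Set
  B g d j f = DegGCD g f j

  InUnionB : ∀ {e} (g : Monic e) (d : ℕ) → Monic d → Set
  InUnionB g d f = Σ ℕ λ j → (1 ≤ j) × (j ≤ d) × B g d j f

  IrrFactor : ∀ {e} (g : Monic e) (i : ℕ) → Monic i → Set
  IrrFactor g i h = Irreducible h × (h ∣ₘ g)

HasCard : {A : Set} → (A → Set) → ℕ → Set
HasCard {A} P n = Σ (List A) λ L → (length L ≡ n) × Unique L × (∀ x → (x ∈ L) ⇔ P x)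

-- Σ_{i=a}^{b} f i  (empty when b < a)
sumRange : ℕ → ℕ → (ℕ → ℕ) → ℕ
sumRange a b f = sum (map (λ t → f (a +ℕ t)) (upTo (suc b ∸ a)))

module Submission where

-- A monic f of degree d lies in B_1 ∪ ... ∪ B_d exactly when f and g share a monic irreducible
-- factor, and a monic h of degree i ≤ d has exactly q^(d-i) monic multiples of degree d.
-- Upper bound: every such f is a multiple of one of the λ*_i irreducible factors of g of some
-- degree k ≤ i ≤ d.  Lower bound: the λ*_k irreducible factors of degree k have λ*_k q^(d-k)
-- multiples in total, counted with multiplicity; by the Bonferroni inequality this exceeds the size
-- of the union by at most the number of multiples common to two distinct factors h, h′, and those
-- are the multiples of the coprime product h h′, at most q^(d-2k) for each of the C(λ*_k, 2) pairs.

open import Defs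
open import Function using (_∘_)
open import Function.Bundles using (Inverse; Injection; Equivalence)
open import Function.Properties.Inverse using (↔⇒↣; ↔-sym)
open import Data.Nat using (ℕ; zero; suc; _+_; _*_; _∸_; _^_; _≤_; _<_; _≤?_; _≟_; s≤s; z≤n)
open import Data.Nat.Properties as ℕₚ
  using (≤-refl; ≤-trans; ≤-reflexive; ≤-pred; <⇒≤; <⇒≱; ≰⇒>; ≤∧≢⇒<; n≢0⇒n>0; m≤m+n; m≤n+m;
             +-mono-≤; *-zeroʳ; *-distribˡ-+; *-distribʳ-+; +-∸-assoc; ∸-monoˡ-<; m+n∸m≡n; m+[n∸m]≡n;
             +-cancelˡ-≡; module ≤-Reasoning)
open import Data.Nat.ListAction using (sum)
open import Data.Nat.Combinatorics using (_C_; nC1≡n; nCk+nC[k+1]≡[n+1]C[k+1])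
open import Data.Fin as Fin using ()
open import Data.List using (List; []; _∷_; map; length; _++_; [_]; concat; filter; upTo; applyUpTo; allFin; cartesianProductWith)
open import Data.List.Properties
  using (length-++; length-map; length-tabulate; map-++; ∷ʳ-injectiveˡ; ∷ʳ-injectiveʳ; map-upTo; map-cong; ≡-dec)
open import Data.List.Membership.Propositional using (_∈_; lose; find)
open import Data.List.Membership.Propositional.Properties
  using (∈-∃++; ∈-map⁺; ∈-map⁻; ∈-allFin; ∈-cartesianProductWith⁺; ∈-upTo⁺; ∈-upTo⁻;
         ∈-filter⁺; ∈-filter⁻; ∈-concat⁺′)
open import Data.List.Relation.Binary.Subset.Propositional using (_⊆_)
open import Data.List.Relation.Unary.Any using (here; there; any?; satisfied)
import Data.List.Relation.Unary.All as All
import Data.List.Relation.Unary.AllPairs as AllPairs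
open AllPairs using (_∷_)
open import Data.List.Relation.Unary.Unique.Propositional using (Unique)
import Data.List.Relation.Unary.Unique.Propositional.Properties as Unique
open import Data.Vec using (Vec; toList; fromList; cast; replicate; zipWith; initLast) renaming ([] to []ᵥ; _∷_ to _∷ᵥ_)
open import Data.Vec.Properties
  using (toList-cast; toList∘fromList; toList-injective; length-toList; cast-is-id; toList-∷ʳ; ∷-injective)
open import Data.Product using (Σ; _×_; _,_; proj₁; proj₂)
open import Data.Sum using (_⊎_; inj₁; inj₂)
open import Data.Empty using (⊥-elim)
open import Relation.Binary.PropositionalEquality hiding ([_])
open import Relation.Binary.Structures using (IsEquivalence)
open import Relation.Binary.Bundles using (Setoid)
open import Relation.Binary.Definitions using (DecidableEquality)
import Relation.Binary.Reasoning.Setoid as SetoidReasoning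
open import Relation.Nullary using (¬_; Dec; yes; no; _×-dec_)
open import Relation.Nullary.Decidable using (via-injection)
open import Relation.Unary using (Pred; Decidable)
open import Algebra.Bundles using (CommutativeRing; CommutativeSemiring)
open import Algebra.Structures.Biased using (IsCommutativeSemiringˡ)
import Algebra.Properties.CommutativeSemigroup as CommutativeSemigroupProperties
open CommutativeSemigroupProperties ℕₚ.+-commutativeSemigroup using () renaming (interchange to +-interchange)

module _ {A : Set} where

  sum-map-+ : ∀ (f g : A → ℕ) xs →
              sum (map (λ x → f x + g x) xs) ≡ sum (map f xs) + sum (map g xs)
  sum-map-+ f g [] = refl
  sum-map-+ f g (x ∷ xs) =
    trans (cong (f x + g x +_) (sum-map-+ f g xs)) (+-interchange (f x) (g x) _ _)

  sum-map-mono-≤ : ∀ {f g : A → ℕ} xs → (∀ {x} → x ∈ xs → f x ≤ g x) →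
                   sum (map f xs) ≤ sum (map g xs)
  sum-map-mono-≤ [] f≤g = z≤n
  sum-map-mono-≤ (x ∷ xs) f≤g = +-mono-≤ (f≤g (here refl)) (sum-map-mono-≤ xs (f≤g ∘ there))

  sum-map-cong : ∀ {f g : A → ℕ} xs → (∀ {x} → x ∈ xs → f x ≡ g x) →
                 sum (map f xs) ≡ sum (map g xs)
  sum-map-cong [] f≡g = refl
  sum-map-cong (x ∷ xs) f≡g = cong₂ _+_ (f≡g (here refl)) (sum-map-cong xs (f≡g ∘ there))

  sum-map-const : ∀ c (xs : List A) → sum (map (λ _ → c) xs) ≡ length xs * c
  sum-map-const c [] = refl
  sum-map-const c (x ∷ xs) = cong (c +_) (sum-map-const c xs)

  *-distribˡ-sum-map : ∀ c (f : A → ℕ) xs → c * sum (map f xs) ≡ sum (map (λ x → c * f x) xs)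
  *-distribˡ-sum-map c f [] = *-zeroʳ c
  *-distribˡ-sum-map c f (x ∷ xs) =
    trans (*-distribˡ-+ c (f x) _) (cong (c * f x +_) (*-distribˡ-sum-map c f xs))

  length-concat-map : ∀ {B : Set} (f : A → List B) xs →
                      length (concat (map f xs)) ≡ sum (map (length ∘ f) xs)
  length-concat-map f [] = refl
  length-concat-map f (x ∷ xs) = trans (length-++ (f x)) (cong (length (f x) +_) (length-concat-map f xs))

  Unique-⊆⇒length≤ : ∀ {xs ys : List A} → Unique xs → xs ⊆ ys → length xs ≤ length ys
  Unique-⊆⇒length≤ {[]} _ _ = z≤n
  Unique-⊆⇒length≤ {x ∷ xs} (x∉xs ∷ !xs) xs⊆ys with ∈-∃++ (xs⊆ys (here refl))
  ... | us , vs , refl = ≤-trans (s≤s (Unique-⊆⇒length≤ !xs xs⊆us++vs)) (≤-reflexive length-split)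
    where
      length-split : suc (length (us ++ vs)) ≡ length (us ++ x ∷ vs)
      length-split = begin
        suc (length (us ++ vs))      ≡⟨ cong suc (length-++ us) ⟩
        suc (length us + length vs)  ≡⟨ sym (ℕₚ.+-suc (length us) (length vs)) ⟩
        length us + suc (length vs)  ≡⟨ sym (length-++ us) ⟩
        length (us ++ x ∷ vs)        ∎
        where open ≡-Reasoning

      remove : ∀ us {z} → z ∈ us ++ x ∷ vs → z ≢ x → z ∈ us ++ vs
      remove [] (here z≡x) z≢x = ⊥-elim (z≢x z≡x)
      remove [] (there z∈vs) _ = z∈vs
      remove (u ∷ us) (here z≡u) _ = here z≡u
      remove (u ∷ us) (there z∈) z≢x = there (remove us z∈ z≢x)

      xs⊆us++vs : xs ⊆ us ++ vs
      xs⊆us++vs {z} z∈xs = remove us (xs⊆ys (there z∈xs)) (λ { refl → All.lookup x∉xs z∈xs refl })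

sum-map-swap : ∀ {A B : Set} (f : A → B → ℕ) xs ys →
               sum (map (λ x → sum (map (f x) ys)) xs) ≡ sum (map (λ y → sum (map (λ x → f x y) xs)) ys)
sum-map-swap f [] ys = sym (trans (sum-map-const 0 ys) (*-zeroʳ (length ys)))
sum-map-swap f (x ∷ xs) ys =
  trans (cong (sum (map (f x) ys) +_) (sum-map-swap f xs ys))
        (sym (sum-map-+ (f x) (λ y → sum (map (λ x′ → f x′ y) xs)) ys))

indicator : ∀ {P : Set} → Dec P → ℕ
indicator (yes _) = 1
indicator (no _)  = 0

indicator≤1 : ∀ {P : Set} (P? : Dec P) → indicator P? ≤ 1
indicator≤1 (yes _) = s≤s z≤n
indicator≤1 (no _)  = z≤n

indicator-×-dec : ∀ {P Q : Set} (P? : Dec P) (Q? : Dec Q) → indicator P? * indicator Q? ≡ indicator (P? ×-dec Q?)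
indicator-×-dec (yes _) (yes _) = refl
indicator-×-dec (yes _) (no _)  = refl
indicator-×-dec (no _)  (yes _) = refl
indicator-×-dec (no _)  (no _)  = refl

sum-map-indicator : ∀ {A : Set} {P : Pred A _} (P? : Decidable P) xs →
                    sum (map (indicator ∘ P?) xs) ≡ length (filter P? xs)
sum-map-indicator P? [] = refl
sum-map-indicator P? (x ∷ xs) with P? x
... | yes _ = cong suc (sum-map-indicator P? xs)
... | no _  = sum-map-indicator P? xs

suc-C2 : ∀ n → suc n C 2 ≡ n + n C 2
suc-C2 n = trans (sym (nCk+nC[k+1]≡[n+1]C[k+1] n 1)) (cong (_+ n C 2) (nC1≡n n))

+-C2 : ∀ b c → b ≤ 1 → (b + c) C 2 ≡ c C 2 + b * c
+-C2 zero    c _ = sym (ℕₚ.+-identityʳ (c C 2))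
+-C2 (suc zero) c _ = trans (suc-C2 c) (trans (ℕₚ.+-comm c (c C 2)) (cong (c C 2 +_) (sym (ℕₚ.+-identityʳ c))))
+-C2 (suc (suc _)) _ (s≤s ())

n≤1+nC2 : ∀ n → n ≤ 1 + n C 2
n≤1+nC2 zero    = z≤n
n≤1+nC2 (suc n) = s≤s (≤-trans (m≤m+n n (n C 2)) (≤-reflexive (sym (suc-C2 n))))

module _ {A H : Set} {P : H → A → Set} (P? : ∀ h → Decidable (P h)) (xs : List A) where

  PairwiseBounded : ℕ → List H → Set
  PairwiseBounded B hs = ∀ {h h′} → h ∈ hs → h′ ∈ hs → h ≢ h′ →
                         length (filter (λ x → P? h x ×-dec P? h′ x) xs) ≤ B

  private
    multiplicity : List H → A → ℕ
    multiplicity hs x = sum (map (λ h → indicator (P? h x)) hs)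

    sum-pairs : ∀ h hs → sum (map (λ x → indicator (P? h x) * multiplicity hs x) xs) ≡
                sum (map (λ h′ → length (filter (λ x → P? h x ×-dec P? h′ x) xs)) hs)
    sum-pairs h hs = begin
      sum (map (λ x → indicator (P? h x) * multiplicity hs x) xs)
        ≡⟨ sum-map-cong xs (λ {x} _ → *-distribˡ-sum-map (indicator (P? h x)) _ hs) ⟩
      sum (map (λ x → sum (map (λ h′ → indicator (P? h x) * indicator (P? h′ x)) hs)) xs)
        ≡⟨ sum-map-swap (λ x h′ → indicator (P? h x) * indicator (P? h′ x)) xs hs ⟩
      sum (map (λ h′ → sum (map (λ x → indicator (P? h x) * indicator (P? h′ x)) xs)) hs)
        ≡⟨ sum-map-cong hs (λ {h′} _ → trans (sum-map-cong xs (λ {x} _ → indicator-×-dec (P? h x) (P? h′ x)))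
                                                (sum-map-indicator (λ x → P? h x ×-dec P? h′ x) xs)) ⟩
      sum (map (λ h′ → length (filter (λ x → P? h x ×-dec P? h′ x) xs)) hs) ∎
      where open ≡-Reasoning

    sum-C2-multiplicity≤ : ∀ {B} hs → Unique hs → PairwiseBounded B hs →
                           sum (map (λ x → multiplicity hs x C 2) xs) ≤ (length hs C 2) * B
    sum-C2-multiplicity≤ {B} [] _ _ = ≤-reflexive (trans (sum-map-const 0 xs) (*-zeroʳ (length xs)))
    sum-C2-multiplicity≤ {B} (h ∷ hs) (h∉hs ∷ !hs) bounded = begin
      sum (map (λ x → multiplicity (h ∷ hs) x C 2) xs)
        ≡⟨ sum-map-cong xs (λ {x} _ → +-C2 (indicator (P? h x)) (multiplicity hs x) (indicator≤1 (P? h x))) ⟩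
      sum (map (λ x → multiplicity hs x C 2 + indicator (P? h x) * multiplicity hs x) xs)
        ≡⟨ sum-map-+ (λ x → multiplicity hs x C 2) (λ x → indicator (P? h x) * multiplicity hs x) xs ⟩
      sum (map (λ x → multiplicity hs x C 2) xs) + sum (map (λ x → indicator (P? h x) * multiplicity hs x) xs)
        ≤⟨ +-mono-≤ (sum-C2-multiplicity≤ hs !hs (λ h∈ h′∈ → bounded (there h∈) (there h′∈))) pairs≤ ⟩
      (length hs C 2) * B + length hs * B
        ≡⟨ trans (ℕₚ.+-comm ((length hs C 2) * B) _) (sym (*-distribʳ-+ B (length hs) _)) ⟩
      (length hs + length hs C 2) * B
        ≡⟨ cong (_* B) (sym (suc-C2 (length hs))) ⟩
      (suc (length hs) C 2) * B ∎
      where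
        open ≤-Reasoning
        pairs≤ : sum (map (λ x → indicator (P? h x) * multiplicity hs x) xs) ≤ length hs * B
        pairs≤ = begin
          sum (map (λ x → indicator (P? h x) * multiplicity hs x) xs)       ≡⟨ sum-pairs h hs ⟩
          sum (map (λ h′ → length (filter (λ x → P? h x ×-dec P? h′ x) xs)) hs)
            ≤⟨ sum-map-mono-≤ hs (λ h′∈hs → bounded (here refl) (there h′∈hs) (λ { refl → All.lookup h∉hs h′∈hs refl })) ⟩
          sum (map (λ _ → B) hs)                                            ≡⟨ sum-map-const B hs ⟩
          length hs * B                                                     ∎

  -- An element lying in m of the sets is counted m ≤ 1 + C(m,2) times on the left.
  bonferroni : ∀ {B} hs → Unique hs → PairwiseBounded B hs →
               sum (map (λ h → length (filter (P? h) xs)) hs) ≤ length xs + (length hs C 2) * B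
  bonferroni {B} hs !hs bounded = begin
    sum (map (λ h → length (filter (P? h) xs)) hs)
      ≡⟨ sum-map-cong hs (λ {h} _ → sym (sum-map-indicator (P? h) xs)) ⟩
    sum (map (λ h → sum (map (λ x → indicator (P? h x)) xs)) hs)
      ≡⟨ sum-map-swap (λ h x → indicator (P? h x)) hs xs ⟩
    sum (map (multiplicity hs) xs)
      ≤⟨ sum-map-mono-≤ xs (λ {x} _ → n≤1+nC2 (multiplicity hs x)) ⟩
    sum (map (λ x → 1 + multiplicity hs x C 2) xs)
      ≡⟨ sum-map-+ (λ _ → 1) (λ x → multiplicity hs x C 2) xs ⟩
    sum (map (λ _ → 1) xs) + sum (map (λ x → multiplicity hs x C 2) xs)
      ≤⟨ +-mono-≤ (≤-reflexive (trans (sum-map-const 1 xs) (ℕₚ.*-identityʳ _))) (sum-C2-multiplicity≤ hs !hs bounded) ⟩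
    length xs + (length hs C 2) * B ∎
    where open ≤-Reasoning

length-cartesianProductWith : ∀ {A B D : Set} (f : A → B → D) xs ys →
                              length (cartesianProductWith f xs ys) ≡ length xs * length ys
length-cartesianProductWith f []       ys = refl
length-cartesianProductWith f (x ∷ xs) ys =
  trans (length-++ (map (f x) ys)) (cong₂ _+_ (length-map (f x) ys) (length-cartesianProductWith f xs ys))

sumRange-unfoldˡ : ∀ {a b} f → a ≤ b → sumRange a b f ≡ f a + sumRange (a + 1) b f
sumRange-unfoldˡ {a} {b} f a≤b = begin
  sum (map (f ∘ (a +_)) (upTo (suc b ∸ a)))                 ≡⟨ cong (λ n → sum (map (f ∘ (a +_)) (upTo n))) (+-∸-assoc 1 a≤b) ⟩
  sum (map (f ∘ (a +_)) (upTo (suc (b ∸ a))))               ≡⟨ cong sum (map-upTo (f ∘ (a +_)) (suc (b ∸ a))) ⟩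
  f (a + 0) + sum (applyUpTo (f ∘ (a +_) ∘ suc) (b ∸ a))     ≡⟨ cong₂ _+_ (cong f (ℕₚ.+-comm a 0)) (cong sum (sym (map-upTo _ (b ∸ a)))) ⟩
  f a + sum (map (f ∘ (a +_) ∘ suc) (upTo (b ∸ a)))
    ≡⟨ cong (λ g → f a + sum g) (map-cong (λ t → cong f (sym (ℕₚ.+-assoc a 1 t))) (upTo (b ∸ a))) ⟩
  f a + sum (map (f ∘ (a + 1 +_)) (upTo (suc b ∸ suc a)))
    ≡⟨ cong (λ n → f a + sum (map (f ∘ (a + 1 +_)) (upTo (suc b ∸ n)))) (ℕₚ.+-comm 1 a) ⟩
  f a + sumRange (a + 1) b f ∎
  where open ≡-Reasoning

HasCard-0⇒∅ : ∀ {A : Set} {P : A → Set} → HasCard P 0 → ∀ {x} → ¬ P x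
HasCard-0⇒∅ ([] , _ , _ , ∈⇔P) Px with Equivalence.from (∈⇔P _) Px
... | ()

module PolynomialArithmetic {q : ℕ} (F : FiniteField q) where

  open FiniteField F renaming (_+_ to _⊕_; _*_ to _⊗_)
  open Polynomials F renaming (_+ₚ_ to infixl 6 _+ₚ_; _*ₚ_ to infixl 7 _*ₚ_)

  coefficientRing : CommutativeRing _ _
  coefficientRing = record { isCommutativeRing = isCommutativeRing }

  open CommutativeRing coefficientRing
    using (+-identityˡ; +-identityʳ; +-comm; +-assoc; *-comm; *-assoc; *-identityˡ; *-identityʳ;
           distribˡ; zeroˡ; zeroʳ; -‿inverseˡ; -‿inverseʳ; +-commutativeSemigroup)
  open CommutativeSemigroupProperties +-commutativeSemigroup using (interchange; x∙yz≈y∙xz)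

  coeff : Poly → ℕ → Carrier
  coeff []      n       = 0#
  coeff (a ∷ p) zero    = a
  coeff (a ∷ p) (suc n) = coeff p n

  -- Coefficient lists differing by trailing zeros denote the same polynomial, so the ring laws
  -- hold only up to coefficientwise equality.
  infix 4 _≈ₚ_
  record _≈ₚ_ (p r : Poly) : Set where
    constructor coeffwise
    field coeff-≡ : ∀ n → coeff p n ≡ coeff r n
  open _≈ₚ_ public

  ≈ₚ-refl : ∀ {p} → p ≈ₚ p
  ≈ₚ-refl = coeffwise λ _ → refl

  ≈ₚ-sym : ∀ {p r} → p ≈ₚ r → r ≈ₚ p
  ≈ₚ-sym p≈r = coeffwise λ n → sym (coeff-≡ p≈r n)

  ≈ₚ-trans : ∀ {p r s} → p ≈ₚ r → r ≈ₚ s → p ≈ₚ s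
  ≈ₚ-trans p≈r r≈s = coeffwise λ n → trans (coeff-≡ p≈r n) (coeff-≡ r≈s n)

  ≈ₚ-isEquivalence : IsEquivalence _≈ₚ_
  ≈ₚ-isEquivalence = record { refl = ≈ₚ-refl ; sym = ≈ₚ-sym ; trans = ≈ₚ-trans }

  ≈ₚ-setoid : Setoid _ _
  ≈ₚ-setoid = record { isEquivalence = ≈ₚ-isEquivalence }

  module ≈ₚ-Reasoning = SetoidReasoning ≈ₚ-setoid

  ≡⇒≈ₚ : ∀ {p r} → p ≡ r → p ≈ₚ r
  ≡⇒≈ₚ refl = ≈ₚ-refl

  ∷-cong : ∀ {a b p r} → a ≡ b → p ≈ₚ r → a ∷ p ≈ₚ b ∷ r
  ∷-cong a≡b p≈r = coeffwise λ { zero → a≡b ; (suc n) → coeff-≡ p≈r n }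

  ∷-injectiveʳ : ∀ {a b p r} → a ∷ p ≈ₚ b ∷ r → p ≈ₚ r
  ∷-injectiveʳ eq = coeffwise λ n → coeff-≡ eq (suc n)

  0∷-zero : ∀ {p} → p ≈ₚ [] → 0# ∷ p ≈ₚ []
  0∷-zero p≈0 = coeffwise λ { zero → refl ; (suc n) → coeff-≡ p≈0 n }

  scale : Carrier → Poly → Poly
  scale a = map (a ⊗_)

  coeff-+ₚ : ∀ p r n → coeff (p +ₚ r) n ≡ coeff p n ⊕ coeff r n
  coeff-+ₚ []      r       n       = sym (+-identityˡ _)
  coeff-+ₚ (a ∷ p) []      n       = sym (+-identityʳ _)
  coeff-+ₚ (a ∷ p) (b ∷ r) zero    = refl
  coeff-+ₚ (a ∷ p) (b ∷ r) (suc n) = coeff-+ₚ p r n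

  coeff-scale : ∀ a p n → coeff (scale a p) n ≡ a ⊗ coeff p n
  coeff-scale a []      n       = sym (zeroʳ a)
  coeff-scale a (b ∷ p) zero    = refl
  coeff-scale a (b ∷ p) (suc n) = coeff-scale a p n

  +ₚ-cong : ∀ {p p′ r r′} → p ≈ₚ p′ → r ≈ₚ r′ → p +ₚ r ≈ₚ p′ +ₚ r′
  +ₚ-cong {p} {p′} {r} {r′} p≈p′ r≈r′ = coeffwise λ n →
    trans (coeff-+ₚ p r n) (trans (cong₂ _⊕_ (coeff-≡ p≈p′ n) (coeff-≡ r≈r′ n)) (sym (coeff-+ₚ p′ r′ n)))

  +ₚ-comm : ∀ p r → p +ₚ r ≈ₚ r +ₚ p
  +ₚ-comm p r = coeffwise λ n → trans (coeff-+ₚ p r n) (trans (+-comm _ _) (sym (coeff-+ₚ r p n)))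

  +ₚ-assoc : ∀ p r s → (p +ₚ r) +ₚ s ≈ₚ p +ₚ (r +ₚ s)
  +ₚ-assoc p r s = coeffwise λ n → begin
    coeff ((p +ₚ r) +ₚ s) n            ≡⟨ trans (coeff-+ₚ (p +ₚ r) s n) (cong (_⊕ coeff s n) (coeff-+ₚ p r n)) ⟩
    (coeff p n ⊕ coeff r n) ⊕ coeff s n ≡⟨ +-assoc _ _ _ ⟩
    coeff p n ⊕ (coeff r n ⊕ coeff s n) ≡⟨ sym (trans (coeff-+ₚ p (r +ₚ s) n) (cong (coeff p n ⊕_) (coeff-+ₚ r s n))) ⟩
    coeff (p +ₚ (r +ₚ s)) n            ∎
    where open ≡-Reasoning

  +ₚ-identityʳ : ∀ p → p +ₚ [] ≈ₚ p
  +ₚ-identityʳ []      = ≈ₚ-refl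
  +ₚ-identityʳ (a ∷ p) = ≈ₚ-refl

  +ₚ-interchange : ∀ p r s t → (p +ₚ r) +ₚ (s +ₚ t) ≈ₚ (p +ₚ s) +ₚ (r +ₚ t)
  +ₚ-interchange p r s t = coeffwise λ n → begin
    coeff ((p +ₚ r) +ₚ (s +ₚ t)) n
      ≡⟨ trans (coeff-+ₚ (p +ₚ r) _ n) (cong₂ _⊕_ (coeff-+ₚ p r n) (coeff-+ₚ s t n)) ⟩
    (coeff p n ⊕ coeff r n) ⊕ (coeff s n ⊕ coeff t n)
      ≡⟨ interchange _ _ _ _ ⟩
    (coeff p n ⊕ coeff s n) ⊕ (coeff r n ⊕ coeff t n)
      ≡⟨ sym (trans (coeff-+ₚ (p +ₚ s) _ n) (cong₂ _⊕_ (coeff-+ₚ p s n) (coeff-+ₚ r t n))) ⟩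
    coeff ((p +ₚ s) +ₚ (r +ₚ t)) n ∎
    where open ≡-Reasoning

  +ₚ-zeroˡ : ∀ {p r} → p ≈ₚ [] → p +ₚ r ≈ₚ r
  +ₚ-zeroˡ {p} {r} p≈0 = coeffwise λ n →
    trans (coeff-+ₚ p r n) (trans (cong (_⊕ coeff r n) (coeff-≡ p≈0 n)) (+-identityˡ _))

  scale-cong : ∀ a {p r} → p ≈ₚ r → scale a p ≈ₚ scale a r
  scale-cong a {p} {r} p≈r = coeffwise λ n →
    trans (coeff-scale a p n) (trans (cong (a ⊗_) (coeff-≡ p≈r n)) (sym (coeff-scale a r n)))

  scale-distrib-+ₚ : ∀ a p r → scale a (p +ₚ r) ≈ₚ scale a p +ₚ scale a r
  scale-distrib-+ₚ a p r = coeffwise λ n → begin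
    coeff (scale a (p +ₚ r)) n            ≡⟨ trans (coeff-scale a (p +ₚ r) n) (cong (a ⊗_) (coeff-+ₚ p r n)) ⟩
    a ⊗ (coeff p n ⊕ coeff r n)           ≡⟨ distribˡ a _ _ ⟩
    a ⊗ coeff p n ⊕ a ⊗ coeff r n         ≡⟨ sym (trans (coeff-+ₚ (scale a p) _ n) (cong₂ _⊕_ (coeff-scale a p n) (coeff-scale a r n))) ⟩
    coeff (scale a p +ₚ scale a r) n      ∎
    where open ≡-Reasoning

  scale-scale : ∀ a b p → scale (a ⊗ b) p ≈ₚ scale a (scale b p)
  scale-scale a b p = coeffwise λ n →
    trans (coeff-scale (a ⊗ b) p n)
          (trans (*-assoc a b _) (sym (trans (coeff-scale a (scale b p) n) (cong (a ⊗_) (coeff-scale b p n)))))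

  scale-zero : ∀ p → scale 0# p ≈ₚ []
  scale-zero p = coeffwise λ n → trans (coeff-scale 0# p n) (zeroˡ _)

  scale-one : ∀ p → scale 1# p ≈ₚ p
  scale-one p = coeffwise λ n → trans (coeff-scale 1# p n) (*-identityˡ _)

  *ₚ-congʳ : ∀ p {r r′} → r ≈ₚ r′ → p *ₚ r ≈ₚ p *ₚ r′
  *ₚ-congʳ []      r≈r′ = ≈ₚ-refl
  *ₚ-congʳ (a ∷ p) r≈r′ = +ₚ-cong (scale-cong a r≈r′) (∷-cong refl (*ₚ-congʳ p r≈r′))

  *ₚ-∷ʳ : ∀ p a r → p *ₚ (a ∷ r) ≈ₚ scale a p +ₚ (0# ∷ (p *ₚ r))
  *ₚ-∷ʳ p a r = coeffwise (go p)
    where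
      go : ∀ p n → coeff (p *ₚ (a ∷ r)) n ≡ coeff (scale a p +ₚ (0# ∷ (p *ₚ r))) n
      go []      zero    = refl
      go []      (suc n) = refl
      go (b ∷ p) zero    = trans (+-identityʳ _) (trans (*-comm b a) (sym (+-identityʳ _)))
      go (b ∷ p) (suc n) = begin
        coeff (scale b r +ₚ (p *ₚ (a ∷ r))) n
          ≡⟨ trans (coeff-+ₚ (scale b r) _ n) (cong (coeff (scale b r) n ⊕_) (trans (go p n) (coeff-+ₚ (scale a p) _ n))) ⟩
        coeff (scale b r) n ⊕ (coeff (scale a p) n ⊕ coeff (0# ∷ (p *ₚ r)) n)
          ≡⟨ x∙yz≈y∙xz _ _ _ ⟩
        coeff (scale a p) n ⊕ (coeff (scale b r) n ⊕ coeff (0# ∷ (p *ₚ r)) n)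
          ≡⟨ sym (trans (coeff-+ₚ (scale a p) _ n) (cong (coeff (scale a p) n ⊕_) (coeff-+ₚ (scale b r) _ n))) ⟩
        coeff (scale a p +ₚ (scale b r +ₚ (0# ∷ (p *ₚ r)))) n ∎
        where open ≡-Reasoning

  *ₚ-comm : ∀ p r → p *ₚ r ≈ₚ r *ₚ p
  *ₚ-comm []      []      = ≈ₚ-refl
  *ₚ-comm []      (b ∷ r) = ≈ₚ-sym (0∷-zero (≈ₚ-sym (*ₚ-comm [] r)))
  *ₚ-comm (a ∷ p) r       = ≈ₚ-trans (+ₚ-cong ≈ₚ-refl (∷-cong refl (*ₚ-comm p r))) (≈ₚ-sym (*ₚ-∷ʳ r a p))

  *ₚ-distribˡ-+ₚ : ∀ p r s → p *ₚ (r +ₚ s) ≈ₚ (p *ₚ r) +ₚ (p *ₚ s)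
  *ₚ-distribˡ-+ₚ []      r s = ≈ₚ-refl
  *ₚ-distribˡ-+ₚ (a ∷ p) r s =
    ≈ₚ-trans (+ₚ-cong (scale-distrib-+ₚ a r s) (∷-cong (sym (+-identityˡ 0#)) (*ₚ-distribˡ-+ₚ p r s)))
             (+ₚ-interchange (scale a r) (scale a s) (0# ∷ (p *ₚ r)) (0# ∷ (p *ₚ s)))

  *ₚ-congˡ : ∀ {p p′} r → p ≈ₚ p′ → p *ₚ r ≈ₚ p′ *ₚ r
  *ₚ-congˡ {p} {p′} r p≈p′ = ≈ₚ-trans (*ₚ-comm p r) (≈ₚ-trans (*ₚ-congʳ r p≈p′) (*ₚ-comm r p′))

  *ₚ-cong : ∀ {p p′ r r′} → p ≈ₚ p′ → r ≈ₚ r′ → p *ₚ r ≈ₚ p′ *ₚ r′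
  *ₚ-cong {p′ = p′} {r = r} p≈p′ r≈r′ = ≈ₚ-trans (*ₚ-congˡ r p≈p′) (*ₚ-congʳ p′ r≈r′)

  *ₚ-distribʳ-+ₚ : ∀ p r s → (p +ₚ r) *ₚ s ≈ₚ (p *ₚ s) +ₚ (r *ₚ s)
  *ₚ-distribʳ-+ₚ p r s =
    ≈ₚ-trans (*ₚ-comm (p +ₚ r) s) (≈ₚ-trans (*ₚ-distribˡ-+ₚ s p r) (+ₚ-cong (*ₚ-comm s p) (*ₚ-comm s r)))

  *ₚ-scaleˡ : ∀ a p r → scale a p *ₚ r ≈ₚ scale a (p *ₚ r)
  *ₚ-scaleˡ a []      r = ≈ₚ-refl
  *ₚ-scaleˡ a (b ∷ p) r =
    ≈ₚ-trans (+ₚ-cong (scale-scale a b r) (∷-cong (sym (zeroʳ a)) (*ₚ-scaleˡ a p r)))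
             (≈ₚ-sym (scale-distrib-+ₚ a (scale b r) (0# ∷ (p *ₚ r))))

  *ₚ-scaleʳ : ∀ p a r → p *ₚ scale a r ≈ₚ scale a (p *ₚ r)
  *ₚ-scaleʳ p a r = ≈ₚ-trans (*ₚ-comm p (scale a r)) (≈ₚ-trans (*ₚ-scaleˡ a r p) (scale-cong a (*ₚ-comm r p)))

  *ₚ-assoc : ∀ p r s → (p *ₚ r) *ₚ s ≈ₚ p *ₚ (r *ₚ s)
  *ₚ-assoc []      r s = ≈ₚ-refl
  *ₚ-assoc (a ∷ p) r s =
    ≈ₚ-trans (*ₚ-distribʳ-+ₚ (scale a r) _ s)
             (+ₚ-cong (*ₚ-scaleˡ a r s) (≈ₚ-trans (+ₚ-zeroˡ (scale-zero s)) (∷-cong refl (*ₚ-assoc p r s))))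

  scale≈const-*ₚ : ∀ a p → scale a p ≈ₚ (a ∷ []) *ₚ p
  scale≈const-*ₚ a p = coeffwise λ n →
    sym (trans (coeff-+ₚ (scale a p) _ n) (trans (cong (coeff (scale a p) n ⊕_) (coeff-0∷[] n)) (+-identityʳ _)))
    where
      coeff-0∷[] : ∀ n → coeff (0# ∷ []) n ≡ 0#
      coeff-0∷[] zero    = refl
      coeff-0∷[] (suc n) = refl

  *ₚ-identityˡ : ∀ p → (1# ∷ []) *ₚ p ≈ₚ p
  *ₚ-identityˡ p = ≈ₚ-trans (≈ₚ-sym (scale≈const-*ₚ 1# p)) (scale-one p)

  *ₚ-identityʳ : ∀ p → p *ₚ (1# ∷ []) ≈ₚ p
  *ₚ-identityʳ p = ≈ₚ-trans (*ₚ-comm p (1# ∷ [])) (*ₚ-identityˡ p)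

  *ₚ-zeroʳ : ∀ p {r} → r ≈ₚ [] → p *ₚ r ≈ₚ []
  *ₚ-zeroʳ p r≈0 = ≈ₚ-trans (*ₚ-congʳ p r≈0) (*ₚ-comm p [])

  polynomialSemiring : CommutativeSemiring _ _
  polynomialSemiring = record
    { Carrier = Poly ; _≈_ = _≈ₚ_ ; _+_ = _+ₚ_ ; _*_ = _*ₚ_ ; 0# = [] ; 1# = 1# ∷ []
    ; isCommutativeSemiring = IsCommutativeSemiringˡ.isCommutativeSemiring (record
      { +-isCommutativeMonoid = record
        { isMonoid = record
          { isSemigroup = record { isMagma = record { isEquivalence = ≈ₚ-isEquivalence ; ∙-cong = +ₚ-cong } ; assoc = +ₚ-assoc }
          ; identity = (λ _ → ≈ₚ-refl) , +ₚ-identityʳ }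
        ; comm = +ₚ-comm }
      ; *-isCommutativeMonoid = record
        { isMonoid = record
          { isSemigroup = record { isMagma = record { isEquivalence = ≈ₚ-isEquivalence ; ∙-cong = *ₚ-cong } ; assoc = *ₚ-assoc }
          ; identity = *ₚ-identityˡ , *ₚ-identityʳ }
        ; comm = *ₚ-comm }
      ; distribʳ = λ s p r → *ₚ-distribʳ-+ₚ p r s
      ; zeroˡ = λ _ → ≈ₚ-refl }) }

module MonicPolynomials {q : ℕ} (F : FiniteField q) where

  open FiniteField F renaming (_+_ to _⊕_; _*_ to _⊗_)
  open Polynomials F renaming (_+ₚ_ to infixl 6 _+ₚ_; _*ₚ_ to infixl 7 _*ₚ_; _∣ₘ_ to infix 4 _∣ₘ_)
  open PolynomialArithmetic F
  open CommutativeRing coefficientRing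
    using (+-identityˡ; +-identityʳ; *-comm; *-assoc; *-identityˡ; *-identityʳ; -‿inverseˡ; -‿inverseʳ; ring)
  open import Algebra.Properties.Ring ring using (-1*x≈-x)
  open import Algebra.Solver.Ring.NaturalCoefficients.Default polynomialSemiring using (solve; _:+_; _:*_; _:=_)
  open CommutativeSemigroupProperties (CommutativeRing.+-commutativeSemigroup coefficientRing) using (x∙yz≈y∙xz)

  _≟ᶠ_ : DecidableEquality Carrier
  _≟ᶠ_ = via-injection (↔⇒↣ finite) Fin._≟_

  length-+ₚ-≤ʳ : ∀ u v → length u ≤ length v → length (u +ₚ v) ≡ length v
  length-+ₚ-≤ʳ []      v       _         = refl
  length-+ₚ-≤ʳ (a ∷ u) (b ∷ v) (s≤s u≤v) = cong suc (length-+ₚ-≤ʳ u v u≤v)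

  length-+ₚ-≤ˡ : ∀ u v → length v ≤ length u → length (u +ₚ v) ≡ length u
  length-+ₚ-≤ˡ []      []      _         = refl
  length-+ₚ-≤ˡ (a ∷ u) []      _         = refl
  length-+ₚ-≤ˡ (a ∷ u) (b ∷ v) (s≤s v≤u) = cong suc (length-+ₚ-≤ˡ u v v≤u)

  +ₚ-∷ʳ-longerʳ : ∀ u v z → length u ≤ length v → u +ₚ (v ++ [ z ]) ≡ (u +ₚ v) ++ [ z ]
  +ₚ-∷ʳ-longerʳ []      v       z _         = refl
  +ₚ-∷ʳ-longerʳ (a ∷ u) (b ∷ v) z (s≤s u≤v) = cong ((a ⊕ b) ∷_) (+ₚ-∷ʳ-longerʳ u v z u≤v)

  +ₚ-∷ʳ-longerˡ : ∀ u v z → length v ≤ length u → (u ++ [ z ]) +ₚ v ≡ (u +ₚ v) ++ [ z ]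
  +ₚ-∷ʳ-longerˡ []      []      z _         = refl
  +ₚ-∷ʳ-longerˡ (a ∷ u) []      z _         = refl
  +ₚ-∷ʳ-longerˡ (a ∷ u) (b ∷ v) z (s≤s v≤u) = cong ((a ⊕ b) ∷_) (+ₚ-∷ʳ-longerˡ u v z v≤u)

  -- An equation of lists, not just ≈ₚ, since _∣ₘ_ is defined by an equation of coefficient lists.
  monic-*ₚ : ∀ p r → Σ (List Carrier) λ s →
             ((p ++ [ 1# ]) *ₚ (r ++ [ 1# ]) ≡ s ++ [ 1# ]) × (length s ≡ length p + length r)
  monic-*ₚ [] [] = [] , cong [_] (trans (+-identityʳ _) (*-identityˡ 1#)) , refl
  monic-*ₚ [] (b ∷ r) = scale 1# (b ∷ r) +ₚ (0# ∷ []) , product≡ , length≡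
    where
      product≡ : scale 1# ((b ∷ r) ++ [ 1# ]) +ₚ (0# ∷ []) ≡ (scale 1# (b ∷ r) +ₚ (0# ∷ [])) ++ [ 1# ]
      product≡ = begin
        scale 1# ((b ∷ r) ++ [ 1# ]) +ₚ (0# ∷ [])      ≡⟨ cong (_+ₚ (0# ∷ [])) (map-++ (1# ⊗_) (b ∷ r) [ 1# ]) ⟩
        (scale 1# (b ∷ r) ++ [ 1# ⊗ 1# ]) +ₚ (0# ∷ []) ≡⟨ +ₚ-∷ʳ-longerˡ (scale 1# (b ∷ r)) (0# ∷ []) (1# ⊗ 1#) (s≤s z≤n) ⟩
        (scale 1# (b ∷ r) +ₚ (0# ∷ [])) ++ [ 1# ⊗ 1# ] ≡⟨ cong (λ c → (scale 1# (b ∷ r) +ₚ (0# ∷ [])) ++ [ c ]) (*-identityˡ 1#) ⟩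
        (scale 1# (b ∷ r) +ₚ (0# ∷ [])) ++ [ 1# ]      ∎
        where open ≡-Reasoning
      length≡ : length (scale 1# (b ∷ r) +ₚ (0# ∷ [])) ≡ suc (length r)
      length≡ = trans (length-+ₚ-≤ˡ (scale 1# (b ∷ r)) (0# ∷ []) (s≤s z≤n)) (length-map _ (b ∷ r))
  monic-*ₚ (a ∷ p) r with monic-*ₚ p r
  ... | s , p*r≡s , |s| = scale a (r ++ [ 1# ]) +ₚ (0# ∷ s) , product≡ , length≡
    where
      shorter : length (scale a (r ++ [ 1# ])) ≤ length (0# ∷ s)
      shorter = ≤-trans (≤-reflexive (trans (length-map _ (r ++ [ 1# ])) (trans (length-++ r) (ℕₚ.+-comm (length r) 1))))
                        (s≤s (≤-trans (m≤n+m (length r) (length p)) (≤-reflexive (sym |s|))))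
      product≡ : scale a (r ++ [ 1# ]) +ₚ (0# ∷ ((p ++ [ 1# ]) *ₚ (r ++ [ 1# ]))) ≡ (scale a (r ++ [ 1# ]) +ₚ (0# ∷ s)) ++ [ 1# ]
      product≡ = trans (cong (λ t → scale a (r ++ [ 1# ]) +ₚ (0# ∷ t)) p*r≡s)
                       (+ₚ-∷ʳ-longerʳ (scale a (r ++ [ 1# ])) (0# ∷ s) 1# shorter)
      length≡ : length (scale a (r ++ [ 1# ]) +ₚ (0# ∷ s)) ≡ suc (length p + length r)
      length≡ = trans (length-+ₚ-≤ʳ (scale a (r ++ [ 1# ])) (0# ∷ s) shorter) (cong suc |s|)

  infixl 7 _*ₘ_
  _*ₘ_ : ∀ {i m} → Monic i → Monic m → Monic (i + m)
  a *ₘ b = cast (trans |s| (cong₂ _+_ (length-toList a) (length-toList b))) (fromList s)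
    where
      s = proj₁ (monic-*ₚ (toList a) (toList b))
      |s| = proj₂ (proj₂ (monic-*ₚ (toList a) (toList b)))

  toPoly-*ₘ : ∀ {i m} (a : Monic i) (b : Monic m) → toPoly a *ₚ toPoly b ≡ toPoly (a *ₘ b)
  toPoly-*ₘ a b with monic-*ₚ (toList a) (toList b)
  ... | s , a*b≡s , |s| = trans a*b≡s (cong (_++ [ 1# ]) (sym (trans (toList-cast _ (fromList s)) (toList∘fromList s))))

  toPoly-injective : ∀ {n} {u v : Monic n} → toPoly u ≡ toPoly v → u ≡ v
  toPoly-injective {u = u} {v} eq =
    trans (sym (cast-is-id refl u)) (toList-injective refl u v (∷ʳ-injectiveˡ (toList u) (toList v) eq))

  degree-*ₘ : ∀ {i m n} (a : Monic i) (b : Monic m) (c : Monic n) → toPoly a *ₚ toPoly b ≡ toPoly c → i + m ≡ n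
  degree-*ₘ a b c ab≡c = begin
    _                              ≡⟨ sym (length-toList (a *ₘ b)) ⟩
    length (toList (a *ₘ b))       ≡⟨ cong length (∷ʳ-injectiveˡ (toList (a *ₘ b)) (toList c) (trans (sym (toPoly-*ₘ a b)) ab≡c)) ⟩
    length (toList c)              ≡⟨ length-toList c ⟩
    _                              ∎
    where open ≡-Reasoning

  coeff-last : ∀ p a → coeff (p ++ [ a ]) (length p) ≡ a
  coeff-last []      a = refl
  coeff-last (b ∷ p) a = coeff-last p a

  1≢0 : 1# ≢ 0#
  1≢0 = 0≢1 ∘ sym

  ≈ₚ-∷ʳ⇒≡ : ∀ p r {a b} → a ≢ 0# → b ≢ 0# → p ++ [ a ] ≈ₚ r ++ [ b ] → p ++ [ a ] ≡ r ++ [ b ]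
  ≈ₚ-∷ʳ⇒≡ []      []      a≢0 b≢0 eq = cong [_] (coeff-≡ eq zero)
  ≈ₚ-∷ʳ⇒≡ []      (c ∷ r) {b = b} a≢0 b≢0 eq = ⊥-elim (b≢0 (trans (sym (coeff-last r b)) (sym (coeff-≡ eq (suc (length r))))))
  ≈ₚ-∷ʳ⇒≡ (c ∷ p) []      {a} a≢0 b≢0 eq = ⊥-elim (a≢0 (trans (sym (coeff-last p a)) (coeff-≡ eq (suc (length p)))))
  ≈ₚ-∷ʳ⇒≡ (c ∷ p) (d ∷ r) a≢0 b≢0 eq = cong₂ _∷_ (coeff-≡ eq zero) (≈ₚ-∷ʳ⇒≡ p r a≢0 b≢0 (∷-injectiveʳ eq))

  toPoly-≈ₚ⇒≡ : ∀ {n} {u v : Monic n} → toPoly u ≈ₚ toPoly v → u ≡ v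
  toPoly-≈ₚ⇒≡ {u = u} {v} eq = toPoly-injective (≈ₚ-∷ʳ⇒≡ (toList u) (toList v) 1≢0 1≢0 eq)

  scale-toPoly≈0⇒0 : ∀ {n} ℓ (v : Monic n) → scale ℓ (toPoly v) ≈ₚ [] → ℓ ≡ 0#
  scale-toPoly≈0⇒0 ℓ v ℓv≈0 = begin
    ℓ                                          ≡⟨ sym (*-identityʳ ℓ) ⟩
    ℓ ⊗ 1#                                     ≡⟨ cong (ℓ ⊗_) (sym (coeff-last (toList v) 1#)) ⟩
    ℓ ⊗ coeff (toPoly v) (length (toList v))   ≡⟨ sym (coeff-scale ℓ (toPoly v) _) ⟩
    coeff (scale ℓ (toPoly v)) _               ≡⟨ coeff-≡ ℓv≈0 _ ⟩
    0#                                         ∎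
    where open ≡-Reasoning

  toPoly≉0 : ∀ {n} (v : Monic n) → ¬ (toPoly v ≈ₚ [])
  toPoly≉0 v v≈0 = 1≢0 (scale-toPoly≈0⇒0 1# v (≈ₚ-trans (scale-one (toPoly v)) v≈0))

  data Normalised (p : Poly) : Set where
    zeroₚ  : p ≈ₚ [] → Normalised p
    scaled : ∀ {m} (v : Monic m) ℓ → ℓ ≢ 0# → p ≈ₚ scale ℓ (toPoly v) → m < length p → Normalised p

  normalise : ∀ p → Normalised p
  normalise [] = zeroₚ ≈ₚ-refl
  normalise (a ∷ p) with normalise p
  ... | zeroₚ p≈0 with a ≟ᶠ 0#
  ...   | yes a≡0 = zeroₚ (coeffwise λ { zero → a≡0 ; (suc n) → coeff-≡ p≈0 n })
  ...   | no a≢0  = scaled []ᵥ a a≢0 (coeffwise λ { zero → sym (*-identityʳ a) ; (suc n) → coeff-≡ p≈0 n }) (s≤s z≤n)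
  normalise (a ∷ p) | scaled v ℓ ℓ≢0 p≈ℓv m<|p| with inverse ℓ ℓ≢0
  ... | ℓ⁻¹ , ℓℓ⁻¹≡1 = scaled ((ℓ⁻¹ ⊗ a) ∷ᵥ v) ℓ ℓ≢0 (∷-cong a≡ℓℓ⁻¹a p≈ℓv) (s≤s m<|p|)
    where
      a≡ℓℓ⁻¹a : a ≡ ℓ ⊗ (ℓ⁻¹ ⊗ a)
      a≡ℓℓ⁻¹a = sym (trans (sym (*-assoc ℓ ℓ⁻¹ a)) (trans (cong (_⊗ a) ℓℓ⁻¹≡1) (*-identityˡ a)))

  infix 4 _∣ₚ_
  _∣ₚ_ : ∀ {i} → Monic i → Poly → Set
  c ∣ₚ p = Σ Poly λ x → toPoly c *ₚ x ≈ₚ p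

  -- Comparing leading coefficients forces ℓ = 1.
  scale-toPoly≈toPoly⇒≡ : ∀ {m n} ℓ (w : Monic m) (h : Monic n) → scale ℓ (toPoly w) ≈ₚ toPoly h → toPoly w ≡ toPoly h
  scale-toPoly≈toPoly⇒≡ ℓ w h ℓw≈h = ≈ₚ-∷ʳ⇒≡ (toList w) (toList h) 1≢0 1≢0 w≈h
    where
      ℓ1≢0 : ℓ ⊗ 1# ≢ 0#
      ℓ1≢0 ℓ1≡0 = toPoly≉0 h (≈ₚ-trans (≈ₚ-sym ℓw≈h) (≈ₚ-trans (≡⇒≈ₚ (cong (λ a → scale a (toPoly w)) ℓ≡0)) (scale-zero (toPoly w))))
        where ℓ≡0 = trans (sym (*-identityʳ ℓ)) ℓ1≡0
      ℓw≡h : scale ℓ (toList w) ++ [ ℓ ⊗ 1# ] ≡ toPoly h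
      ℓw≡h = ≈ₚ-∷ʳ⇒≡ (scale ℓ (toList w)) (toList h) ℓ1≢0 1≢0
               (≈ₚ-trans (≡⇒≈ₚ (sym (map-++ (ℓ ⊗_) (toList w) [ 1# ]))) ℓw≈h)
      ℓ≡1 : ℓ ≡ 1#
      ℓ≡1 = trans (sym (*-identityʳ ℓ)) (∷ʳ-injectiveʳ (scale ℓ (toList w)) (toList h) ℓw≡h)
      w≈h : toPoly w ≈ₚ toPoly h
      w≈h = ≈ₚ-trans (≈ₚ-sym (scale-one (toPoly w))) (subst (λ a → scale a (toPoly w) ≈ₚ toPoly h) ℓ≡1 ℓw≈h)

  ∣ₚ⇒∣ₘ : ∀ {i n} (c : Monic i) (h : Monic n) → c ∣ₚ toPoly h → c ∣ₘ h
  ∣ₚ⇒∣ₘ c h (x , cx≈h) with normalise x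
  ... | zeroₚ x≈0 = ⊥-elim (toPoly≉0 h (≈ₚ-trans (≈ₚ-sym cx≈h) (*ₚ-zeroʳ (toPoly c) x≈0)))
  ... | scaled {m} v ℓ _ x≈ℓv _ = m , v , trans (toPoly-*ₘ c v) (scale-toPoly≈toPoly⇒≡ ℓ (c *ₘ v) h ℓcv≈h)
    where
      ℓcv≈h : scale ℓ (toPoly (c *ₘ v)) ≈ₚ toPoly h
      ℓcv≈h = ≈ₚ-trans (scale-cong ℓ (≡⇒≈ₚ (sym (toPoly-*ₘ c v))))
                (≈ₚ-trans (≈ₚ-sym (*ₚ-scaleʳ (toPoly c) ℓ (toPoly v))) (≈ₚ-trans (*ₚ-congʳ (toPoly c) (≈ₚ-sym x≈ℓv)) cx≈h))

  ∣ₚ-refl : ∀ {i} (c : Monic i) → c ∣ₚ toPoly c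
  ∣ₚ-refl c = (1# ∷ []) , *ₚ-identityʳ (toPoly c)

  ∣ₘ-refl : ∀ {i} (c : Monic i) → c ∣ₘ c
  ∣ₘ-refl c = ∣ₚ⇒∣ₘ c c (∣ₚ-refl c)

  ∣ₘ-trans : ∀ {i j n} {a : Monic i} {b : Monic j} {c : Monic n} → a ∣ₘ b → b ∣ₘ c → a ∣ₘ c
  ∣ₘ-trans {a = a} {c = c} (_ , x , ax≡b) (_ , y , by≡c) = ∣ₚ⇒∣ₘ a c (toPoly x *ₚ toPoly y ,
    ≈ₚ-trans (≈ₚ-sym (*ₚ-assoc (toPoly a) (toPoly x) (toPoly y))) (≈ₚ-trans (*ₚ-congˡ (toPoly y) (≡⇒≈ₚ ax≡b)) (≡⇒≈ₚ by≡c)))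

  ∣ₘ⇒≤ : ∀ {i n} {c : Monic i} {h : Monic n} → c ∣ₘ h → i ≤ n
  ∣ₘ⇒≤ {i} {c = c} {h} (m , v , cv≡h) = subst (i ≤_) (degree-*ₘ c v h cv≡h) (m≤m+n i m)

  ∣ₘ-same-degree⇒≡ : ∀ {i} {c h : Monic i} → c ∣ₘ h → c ≡ h
  ∣ₘ-same-degree⇒≡ {i} {c} {h} (m , v , cv≡h) with +-cancelˡ-≡ i m 0 (trans (degree-*ₘ c v h cv≡h) (sym (ℕₚ.+-identityʳ i)))
  ∣ₘ-same-degree⇒≡ {i} {c} {h} (.0 , []ᵥ , cv≡h) | refl =
    toPoly-≈ₚ⇒≡ (≈ₚ-trans (≈ₚ-sym (*ₚ-identityʳ (toPoly c))) (≡⇒≈ₚ cv≡h))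

  negate : Poly → Poly
  negate = scale (- 1#)

  coeff-negate : ∀ p n → coeff (negate p) n ≡ - coeff p n
  coeff-negate p n = trans (coeff-scale (- 1#) p n) (-1*x≈-x _)

  +ₚ-inverseʳ : ∀ p → p +ₚ negate p ≈ₚ []
  +ₚ-inverseʳ p = coeffwise λ n → trans (coeff-+ₚ p (negate p) n) (trans (cong (coeff p n ⊕_) (coeff-negate p n)) (-‿inverseʳ _))

  +ₚ-negate-cancelʳ : ∀ p r → (p +ₚ negate r) +ₚ r ≈ₚ p
  +ₚ-negate-cancelʳ p r = ≈ₚ-trans (+ₚ-assoc p (negate r) r)
    (≈ₚ-trans (+ₚ-cong ≈ₚ-refl (≈ₚ-trans (+ₚ-comm (negate r) r) (+ₚ-inverseʳ r))) (+ₚ-identityʳ p))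

  *ₘ-cancelˡ : ∀ {i m} (h : Monic i) {v v′ : Monic m} → toPoly h *ₚ toPoly v ≡ toPoly h *ₚ toPoly v′ → v ≡ v′
  *ₘ-cancelˡ h {v} {v′} hv≡hv′ with normalise (toPoly v +ₚ negate (toPoly v′))
  ... | zeroₚ v-v′≈0 = toPoly-≈ₚ⇒≡ (≈ₚ-trans (≈ₚ-sym (+ₚ-negate-cancelʳ (toPoly v) (toPoly v′))) (+ₚ-zeroˡ v-v′≈0))
  ... | scaled w ℓ ℓ≢0 v-v′≈ℓw _ = ⊥-elim (ℓ≢0 (scale-toPoly≈0⇒0 ℓ (h *ₘ w) ℓhw≈0))
    where
      H = toPoly h
      h[v-v′]≈0 : H *ₚ (toPoly v +ₚ negate (toPoly v′)) ≈ₚ []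
      h[v-v′]≈0 = ≈ₚ-trans (*ₚ-distribˡ-+ₚ H (toPoly v) _)
                    (≈ₚ-trans (+ₚ-cong (≡⇒≈ₚ hv≡hv′) (*ₚ-scaleʳ H (- 1#) (toPoly v′))) (+ₚ-inverseʳ (H *ₚ toPoly v′)))
      ℓhw≈0 : scale ℓ (toPoly (h *ₘ w)) ≈ₚ []
      ℓhw≈0 = ≈ₚ-trans (scale-cong ℓ (≡⇒≈ₚ (sym (toPoly-*ₘ h w))))
                (≈ₚ-trans (≈ₚ-sym (*ₚ-scaleʳ H ℓ (toPoly w))) (≈ₚ-trans (*ₚ-congʳ H (≈ₚ-sym v-v′≈ℓw)) h[v-v′]≈0))

  record Division {n} (p : Poly) (h : Monic n) : Set where
    constructor division
    field
      quotient  : Poly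
      remainder : Vec Carrier n
      p≈qh+r    : p ≈ₚ (quotient *ₚ toPoly h) +ₚ toList remainder

  []≈zeros : ∀ n → [] ≈ₚ toList (replicate n 0#)
  []≈zeros zero    = ≈ₚ-refl
  []≈zeros (suc n) = ≈ₚ-sym (0∷-zero (≈ₚ-sym ([]≈zeros n)))

  subtract-leading : ∀ {n} c (w h : Vec Carrier n) →
                     toList w ++ [ c ] ≈ₚ scale c (toPoly h) +ₚ toList (zipWith (λ y z → y ⊕ - (c ⊗ z)) w h)
  subtract-leading c []ᵥ       []ᵥ       = ∷-cong (sym (*-identityʳ c)) ≈ₚ-refl
  subtract-leading c (y ∷ᵥ w) (z ∷ᵥ h) = ∷-cong (sym (x∙yz≈y∙xz′)) (subtract-leading c w h)
    where
      x∙yz≈y∙xz′ : c ⊗ z ⊕ (y ⊕ - (c ⊗ z)) ≡ y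
      x∙yz≈y∙xz′ = trans (x∙yz≈y∙xz (c ⊗ z) y _) (trans (cong (y ⊕_) (-‿inverseʳ (c ⊗ z))) (+-identityʳ y))

  divide : ∀ {n} p (h : Monic n) → Division p h
  divide {n} [] h = division [] (replicate n 0#) ([]≈zeros n)
  divide (a ∷ p) h with divide p h
  ... | division Q R p≈QH+R with initLast (a ∷ᵥ R)
  ... | w , c , aR≡w∷ʳc = division (c ∷ Q) (zipWith (λ y z → y ⊕ - (c ⊗ z)) w h) (begin
    a ∷ p                                                    ≈⟨ ∷-cong (sym (+-identityˡ a)) p≈QH+R ⟩
    (0# ∷ (Q *ₚ H)) +ₚ (a ∷ toList R)
      ≈⟨ +ₚ-cong (≈ₚ-refl {0# ∷ (Q *ₚ H)}) (≡⇒≈ₚ (trans (cong toList aR≡w∷ʳc) (toList-∷ʳ c w))) ⟩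
    (0# ∷ (Q *ₚ H)) +ₚ (toList w ++ [ c ])                    ≈⟨ +ₚ-cong (≈ₚ-refl {0# ∷ (Q *ₚ H)}) (subtract-leading c w h) ⟩
    (0# ∷ (Q *ₚ H)) +ₚ (scale c H +ₚ toList R′)               ≈⟨ ≈ₚ-sym (+ₚ-assoc (0# ∷ (Q *ₚ H)) (scale c H) _) ⟩
    ((0# ∷ (Q *ₚ H)) +ₚ scale c H) +ₚ toList R′               ≈⟨ +ₚ-cong (+ₚ-comm (0# ∷ (Q *ₚ H)) (scale c H)) ≈ₚ-refl ⟩
    ((c ∷ Q) *ₚ H) +ₚ toList R′                               ∎)
    where
      open ≈ₚ-Reasoning
      H = toPoly h
      R′ = zipWith (λ y z → y ⊕ - (c ⊗ z)) w h

  negate-*ₚ-cancel : ∀ p r → negate p *ₚ r +ₚ p *ₚ r ≈ₚ []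
  negate-*ₚ-cancel p r = ≈ₚ-trans (+ₚ-cong (*ₚ-scaleˡ (- 1#) p r) ≈ₚ-refl)
                           (≈ₚ-trans (+ₚ-comm (negate (p *ₚ r)) (p *ₚ r)) (+ₚ-inverseʳ (p *ₚ r)))

  *ₚ-x∙yz≈y∙xz : ∀ p r s → p *ₚ (r *ₚ s) ≈ₚ r *ₚ (p *ₚ s)
  *ₚ-x∙yz≈y∙xz = solve 3 (λ p r s → p :* (r :* s) := r :* (p :* s)) ≈ₚ-refl

  euclid-rearrangement : ∀ v N A L Q R →
    (v +ₚ N) *ₚ A +ₚ L *ₚ (Q *ₚ A +ₚ R) ≈ₚ (v *ₚ A +ₚ L *ₚ R) +ₚ (N *ₚ A +ₚ (L *ₚ Q) *ₚ A)
  euclid-rearrangement = solve 6 (λ v N A L Q R →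
    (v :+ N) :* A :+ L :* (Q :* A :+ R) := (v :* A :+ L :* R) :+ (N :* A :+ (L :* Q) :* A)) ≈ₚ-refl

  record BézoutGCD {n} (a : Monic n) (b : Poly) : Set where
    constructor bézoutGCD
    field
      {degree} : ℕ
      divisor  : Monic degree
      ∣a       : divisor ∣ₚ toPoly a
      ∣b       : divisor ∣ₚ b
      u v      : Poly
      bézout   : toPoly divisor ≈ₚ (u *ₚ toPoly a) +ₚ (v *ₚ b)

  bézoutGCD-step : ∀ {n m} {a : Monic n} {b : Poly} (Q : Poly) (r : Monic m) ℓ → ℓ ≢ 0# →
                   b ≈ₚ Q *ₚ toPoly a +ₚ scale ℓ (toPoly r) → BézoutGCD r (toPoly a) → BézoutGCD a b
  bézoutGCD-step {a = a} {b} Q r ℓ ℓ≢0 b≈Qa+ℓr (bézoutGCD G (x , Gx≈r) (y , Gy≈a) u v G≈ur+va) with inverse ℓ ℓ≢0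
  ... | ℓ⁻¹ , ℓℓ⁻¹≡1 = bézoutGCD G (y , Gy≈a) (Q *ₚ y +ₚ scale ℓ x , G∣b) (v +ₚ negate (L *ₚ Q)) L bézout
    where
      open ≈ₚ-Reasoning
      A = toPoly a
      Gp = toPoly G
      R = scale ℓ (toPoly r)
      L = scale ℓ⁻¹ u
      G∣b : Gp *ₚ (Q *ₚ y +ₚ scale ℓ x) ≈ₚ b
      G∣b = begin
        Gp *ₚ (Q *ₚ y +ₚ scale ℓ x)                ≈⟨ *ₚ-distribˡ-+ₚ Gp (Q *ₚ y) (scale ℓ x) ⟩
        Gp *ₚ (Q *ₚ y) +ₚ Gp *ₚ scale ℓ x          ≈⟨ +ₚ-cong (*ₚ-x∙yz≈y∙xz Gp Q y) (*ₚ-scaleʳ Gp ℓ x) ⟩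
        Q *ₚ (Gp *ₚ y) +ₚ scale ℓ (Gp *ₚ x)        ≈⟨ +ₚ-cong (*ₚ-congʳ Q Gy≈a) (scale-cong ℓ Gx≈r) ⟩
        Q *ₚ A +ₚ R                                ≈⟨ ≈ₚ-sym b≈Qa+ℓr ⟩
        b                                          ∎
      r≈ℓ⁻¹R : toPoly r ≈ₚ scale ℓ⁻¹ R
      r≈ℓ⁻¹R = begin
        toPoly r                       ≈⟨ ≈ₚ-sym (scale-one (toPoly r)) ⟩
        scale 1# (toPoly r)            ≈⟨ ≡⇒≈ₚ (cong (λ c → scale c (toPoly r)) (sym (trans (*-comm ℓ⁻¹ ℓ) ℓℓ⁻¹≡1))) ⟩
        scale (ℓ⁻¹ ⊗ ℓ) (toPoly r)     ≈⟨ scale-scale ℓ⁻¹ ℓ (toPoly r) ⟩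
        scale ℓ⁻¹ R                    ∎
      bézout : Gp ≈ₚ (v +ₚ negate (L *ₚ Q)) *ₚ A +ₚ L *ₚ b
      bézout = begin
        Gp                                                 ≈⟨ G≈ur+va ⟩
        u *ₚ toPoly r +ₚ v *ₚ A                            ≈⟨ +ₚ-comm (u *ₚ toPoly r) (v *ₚ A) ⟩
        v *ₚ A +ₚ u *ₚ toPoly r                            ≈⟨ +ₚ-cong ≈ₚ-refl (*ₚ-congʳ u r≈ℓ⁻¹R) ⟩
        v *ₚ A +ₚ u *ₚ scale ℓ⁻¹ R                         ≈⟨ +ₚ-cong ≈ₚ-refl (≈ₚ-trans (*ₚ-scaleʳ u ℓ⁻¹ R) (≈ₚ-sym (*ₚ-scaleˡ ℓ⁻¹ u R))) ⟩
        v *ₚ A +ₚ L *ₚ R                                   ≈⟨ ≈ₚ-sym (+ₚ-identityʳ _) ⟩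
        (v *ₚ A +ₚ L *ₚ R) +ₚ []                           ≈⟨ +ₚ-cong ≈ₚ-refl (≈ₚ-sym (negate-*ₚ-cancel (L *ₚ Q) A)) ⟩
        (v *ₚ A +ₚ L *ₚ R) +ₚ (negate (L *ₚ Q) *ₚ A +ₚ (L *ₚ Q) *ₚ A)
                                                           ≈⟨ ≈ₚ-sym (euclid-rearrangement v (negate (L *ₚ Q)) A L Q R) ⟩
        (v +ₚ negate (L *ₚ Q)) *ₚ A +ₚ L *ₚ (Q *ₚ A +ₚ R)   ≈⟨ +ₚ-cong ≈ₚ-refl (*ₚ-congʳ L (≈ₚ-sym b≈Qa+ℓr)) ⟩
        (v +ₚ negate (L *ₚ Q)) *ₚ A +ₚ L *ₚ b              ∎

  private
    euclid : ∀ fuel {n} → n ≤ fuel → (a : Monic n) (b : Poly) → BézoutGCD a b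
    euclid fuel {n} n≤fuel a b with divide b a
    ... | division Q R b≈Qa+R with normalise (toList R)
    ...   | zeroₚ R≈0 = bézoutGCD a (∣ₚ-refl a) (Q , a∣b) (1# ∷ []) [] a≈1a+0b
      where
        a∣b : toPoly a *ₚ Q ≈ₚ b
        a∣b = ≈ₚ-trans (*ₚ-comm (toPoly a) Q)
                (≈ₚ-trans (≈ₚ-sym (+ₚ-identityʳ _)) (≈ₚ-trans (+ₚ-cong ≈ₚ-refl (≈ₚ-sym R≈0)) (≈ₚ-sym b≈Qa+R)))
        a≈1a+0b : toPoly a ≈ₚ (1# ∷ []) *ₚ toPoly a +ₚ [] *ₚ b
        a≈1a+0b = ≈ₚ-sym (≈ₚ-trans (+ₚ-identityʳ _) (*ₚ-identityˡ (toPoly a)))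
    ...   | scaled {m} r ℓ ℓ≢0 R≈ℓr m<|R| =
      bézoutGCD-step Q r ℓ ℓ≢0 (≈ₚ-trans b≈Qa+R (+ₚ-cong ≈ₚ-refl R≈ℓr)) (recurse fuel n≤fuel)
      where
        m<n : m < n
        m<n = ≤-trans m<|R| (≤-reflexive (length-toList R))
        recurse : ∀ fuel → n ≤ fuel → BézoutGCD r (toPoly a)
        recurse zero       n≤0      = ⊥-elim (ℕₚ.n≮0 (≤-trans m<n n≤0))
        recurse (suc fuel) n≤1+fuel = euclid fuel (≤-pred (≤-trans m<n n≤1+fuel)) r (toPoly a)

  bézout-gcd : ∀ {n} (a : Monic n) (b : Poly) → BézoutGCD a b
  bézout-gcd {n} = euclid n ≤-refl

  gcd : ∀ {e d} (g : Monic e) (f : Monic d) → Σ ℕ (DegGCD g f)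
  gcd g f with bézout-gcd g (toPoly f)
  ... | bézoutGCD {j} G G∣g G∣f u v G≈ug+vf = j , G , ∣ₚ⇒∣ₘ G g G∣g , ∣ₚ⇒∣ₘ G f G∣f , greatest
    where
      greatest : ∀ m (c : Monic m) → c ∣ₘ g → c ∣ₘ f → c ∣ₘ G
      greatest m c (_ , x , cx≡g) (_ , y , cy≡f) = ∣ₚ⇒∣ₘ c G (u *ₚ toPoly x +ₚ v *ₚ toPoly y , (begin
        toPoly c *ₚ (u *ₚ toPoly x +ₚ v *ₚ toPoly y)        ≈⟨ *ₚ-distribˡ-+ₚ (toPoly c) _ _ ⟩
        toPoly c *ₚ (u *ₚ toPoly x) +ₚ toPoly c *ₚ (v *ₚ toPoly y)
                                                           ≈⟨ +ₚ-cong (*ₚ-x∙yz≈y∙xz (toPoly c) u (toPoly x)) (*ₚ-x∙yz≈y∙xz (toPoly c) v (toPoly y)) ⟩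
        u *ₚ (toPoly c *ₚ toPoly x) +ₚ v *ₚ (toPoly c *ₚ toPoly y)
                                                           ≈⟨ +ₚ-cong (*ₚ-congʳ u (≡⇒≈ₚ cx≡g)) (*ₚ-congʳ v (≡⇒≈ₚ cy≡f)) ⟩
        u *ₚ toPoly g +ₚ v *ₚ toPoly f                     ≈⟨ ≈ₚ-sym G≈ug+vf ⟩
        toPoly G                                           ∎))
        where open ≈ₚ-Reasoning

  coprime-∣-*ₘ⇒∣ : ∀ {i j m n} (h : Monic i) (h′ : Monic j) (c : Monic m) {x : Monic n} (u v : Poly) →
                    (1# ∷ []) ≈ₚ u *ₚ toPoly h′ +ₚ v *ₚ toPoly h → toPoly h *ₚ toPoly c ≡ toPoly x → h′ ∣ₘ x → h′ ∣ₘ c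
  coprime-∣-*ₘ⇒∣ h h′ c u v 1≈uh′+vh hc≡x (_ , y , h′y≡x) = ∣ₚ⇒∣ₘ h′ c (u *ₚ Cₚ +ₚ v *ₚ toPoly y , (begin
    H′ *ₚ (u *ₚ Cₚ +ₚ v *ₚ toPoly y)           ≈⟨ *ₚ-distribˡ-+ₚ H′ _ _ ⟩
    H′ *ₚ (u *ₚ Cₚ) +ₚ H′ *ₚ (v *ₚ toPoly y)   ≈⟨ +ₚ-cong (*ₚ-x∙yz≈y∙xz H′ u Cₚ) (*ₚ-x∙yz≈y∙xz H′ v (toPoly y)) ⟩
    u *ₚ (H′ *ₚ Cₚ) +ₚ v *ₚ (H′ *ₚ toPoly y)   ≈⟨ +ₚ-cong ≈ₚ-refl (*ₚ-congʳ v (≡⇒≈ₚ (trans h′y≡x (sym hc≡x)))) ⟩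
    u *ₚ (H′ *ₚ Cₚ) +ₚ v *ₚ (H *ₚ Cₚ)           ≈⟨ ≈ₚ-sym (+ₚ-cong (*ₚ-assoc u H′ Cₚ) (*ₚ-assoc v H Cₚ)) ⟩
    u *ₚ H′ *ₚ Cₚ +ₚ v *ₚ H *ₚ Cₚ               ≈⟨ ≈ₚ-sym (*ₚ-distribʳ-+ₚ (u *ₚ H′) (v *ₚ H) Cₚ) ⟩
    (u *ₚ H′ +ₚ v *ₚ H) *ₚ Cₚ                  ≈⟨ *ₚ-congˡ Cₚ (≈ₚ-sym 1≈uh′+vh) ⟩
    (1# ∷ []) *ₚ Cₚ                            ≈⟨ *ₚ-identityˡ Cₚ ⟩
    Cₚ                                         ∎))
    where
      open ≈ₚ-Reasoning
      H = toPoly h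
      H′ = toPoly h′
      Cₚ = toPoly c

  coprime-*ₘ-∣ : ∀ {i j n} (h : Monic i) (h′ : Monic j) {x : Monic n} (u v : Poly) →
                 (1# ∷ []) ≈ₚ u *ₚ toPoly h′ +ₚ v *ₚ toPoly h → h ∣ₘ x → h′ ∣ₘ x → h *ₘ h′ ∣ₘ x
  coprime-*ₘ-∣ h h′ {x} u v 1≈uh′+vh (_ , c , hc≡x) h′∣x
    with coprime-∣-*ₘ⇒∣ h h′ c u v 1≈uh′+vh hc≡x h′∣x
  ... | _ , z , h′z≡c = ∣ₚ⇒∣ₘ (h *ₘ h′) x (toPoly z , (begin
    toPoly (h *ₘ h′) *ₚ toPoly z        ≈⟨ *ₚ-congˡ (toPoly z) (≡⇒≈ₚ (sym (toPoly-*ₘ h h′))) ⟩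
    toPoly h *ₚ toPoly h′ *ₚ toPoly z   ≈⟨ *ₚ-assoc (toPoly h) (toPoly h′) (toPoly z) ⟩
    toPoly h *ₚ (toPoly h′ *ₚ toPoly z) ≈⟨ *ₚ-congʳ (toPoly h) (≡⇒≈ₚ h′z≡c) ⟩
    toPoly h *ₚ toPoly c                ≈⟨ ≡⇒≈ₚ hc≡x ⟩
    toPoly x                            ∎))
    where open ≈ₚ-Reasoning

  toPoly-constant : (c : Monic 0) → toPoly c ≡ 1# ∷ []
  toPoly-constant []ᵥ = refl

  irreducible-*ₘ-∣ : ∀ {i j n} {h : Monic i} {h′ : Monic j} {x : Monic n} →
                     Irreducible h′ → ¬ (h′ ∣ₘ h) → h ∣ₘ x → h′ ∣ₘ x → h *ₘ h′ ∣ₘ x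
  irreducible-*ₘ-∣ {h = h} {h′} (_ , trivial-divisors) h′∤h h∣x h′∣x with bézout-gcd h′ (toPoly h)
  ... | bézoutGCD {d} G G∣h′ G∣h u v G≈uh′+vh with trivial-divisors d G (∣ₚ⇒∣ₘ G h′ G∣h′)
  ... | inj₁ refl = coprime-*ₘ-∣ h h′ u v (≈ₚ-trans (≡⇒≈ₚ (sym (toPoly-constant G))) G≈uh′+vh) h∣x h′∣x
  ... | inj₂ refl = ⊥-elim (h′∤h (subst (_∣ₘ h) (∣ₘ-same-degree⇒≡ {c = G} {h′} (∣ₚ⇒∣ₘ G h′ G∣h′)) (∣ₚ⇒∣ₘ G h G∣h)))

module Enumeration {q : ℕ} (F : FiniteField q) where

  open FiniteField F renaming (_+_ to _⊕_; _*_ to _⊗_)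
  open Polynomials F renaming (_+ₚ_ to infixl 6 _+ₚ_; _*ₚ_ to infixl 7 _*ₚ_; _∣ₘ_ to infix 4 _∣ₘ_)
  open PolynomialArithmetic F
  open MonicPolynomials F

  coefficients : List Carrier
  coefficients = map (Inverse.from finite) (allFin q)

  ∈-coefficients : ∀ a → a ∈ coefficients
  ∈-coefficients a =
    subst (_∈ coefficients) (Inverse.inverseʳ finite refl) (∈-map⁺ (Inverse.from finite) (∈-allFin (Inverse.to finite a)))

  length-coefficients : length coefficients ≡ q
  length-coefficients = trans (length-map _ (allFin q)) (length-tabulate (λ i → i))

  coefficients-unique : Unique coefficients
  coefficients-unique = Unique.map⁺ (Injection.injective (↔⇒↣ (↔-sym finite))) (Unique.allFin⁺ q)

  monics : ∀ n → List (Monic n)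
  monics zero    = []ᵥ ∷ []
  monics (suc n) = cartesianProductWith _∷ᵥ_ coefficients (monics n)

  length-monics : ∀ n → length (monics n) ≡ q ^ n
  length-monics zero    = refl
  length-monics (suc n) = trans (length-cartesianProductWith _∷ᵥ_ coefficients (monics n)) (cong₂ _*_ length-coefficients (length-monics n))

  ∈-monics : ∀ {n} (v : Monic n) → v ∈ monics n
  ∈-monics []ᵥ       = here refl
  ∈-monics (a ∷ᵥ v) = ∈-cartesianProductWith⁺ _∷ᵥ_ (∈-coefficients a) (∈-monics v)

  monics-unique : ∀ n → Unique (monics n)
  monics-unique zero    = All.[] AllPairs.∷ AllPairs.[]
  monics-unique (suc n) = Unique.cartesianProductWith⁺ _∷ᵥ_ ∷-injective coefficients-unique (monics-unique n)

  ∣ₘ⇒cofactor : ∀ {i n} (c : Monic i) (f : Monic n) → c ∣ₘ f →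
                Σ (Monic (n ∸ i)) λ v → toPoly c *ₚ toPoly v ≡ toPoly f
  ∣ₘ⇒cofactor {i} c f (m , v , cv≡f) with degree-*ₘ c v f cv≡f
  ... | refl = subst (λ k → Σ (Monic k) λ v → toPoly c *ₚ toPoly v ≡ toPoly f) (sym (m+n∸m≡n i m)) (v , cv≡f)

  infix 4 _∣ₘ?_
  _∣ₘ?_ : ∀ {i n} (c : Monic i) (f : Monic n) → Dec (c ∣ₘ f)
  _∣ₘ?_ {i} {n} c f with any? (λ v → ≡-dec _≟ᶠ_ (toPoly c *ₚ toPoly v) (toPoly f)) (monics (n ∸ i))
  ... | yes found = yes (n ∸ i , satisfied found)
  ... | no none   = no λ c∣f → let v , cv≡f = ∣ₘ⇒cofactor c f c∣f in none (lose (∈-monics v) cv≡f)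

  private
    irreducible-factor′ : ∀ fuel {j} → j ≤ fuel → (G : Monic j) → 1 ≤ j →
                          Σ ℕ λ i → Σ (Monic i) λ h → Irreducible h × h ∣ₘ G
    irreducible-factor′ zero j≤0 G 1≤j = ⊥-elim (<⇒≱ 1≤j j≤0)
    irreducible-factor′ (suc fuel) {j} j≤fuel G 1≤j
      with any? (λ i → 1 ≤? i ×-dec any? (_∣ₘ? G) (monics i)) (upTo j)
    ... | yes found with find found
    ...   | i , i∈upTo , 1≤i , c∣G-somewhere with satisfied c∣G-somewhere
    ...     | c , c∣G with irreducible-factor′ fuel (≤-pred (≤-trans (∈-upTo⁻ i∈upTo) j≤fuel)) c 1≤i
    ...       | i′ , h , irreducible , h∣c = i′ , h , irreducible , ∣ₘ-trans {a = h} {c} h∣c c∣G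
    irreducible-factor′ (suc fuel) {j} j≤fuel G 1≤j | no none = j , G , (1≤j , trivial) , ∣ₘ-refl G
      where
        trivial : ∀ i (c : Monic i) → c ∣ₘ G → (i ≡ 0) ⊎ (i ≡ j)
        trivial i c c∣G with i ≟ 0 | i ≟ j
        ... | yes i≡0 | _       = inj₁ i≡0
        ... | no _    | yes i≡j = inj₂ i≡j
        ... | no i≢0  | no i≢j  =
          ⊥-elim (none (lose (∈-upTo⁺ (≤∧≢⇒< (∣ₘ⇒≤ {c = c} {G} c∣G) i≢j)) (n≢0⇒n>0 i≢0 , lose (∈-monics c) c∣G)))

  irreducible-factor : ∀ {j} (G : Monic j) → 1 ≤ j → Σ ℕ λ i → Σ (Monic i) λ h → Irreducible h × h ∣ₘ G
  irreducible-factor {j} = irreducible-factor′ j ≤-refl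

  multiple : ∀ {i d} (h : Monic i) → i ≤ d → Monic (d ∸ i) → Monic d
  multiple h i≤d v = cast (m+[n∸m]≡n i≤d) (h *ₘ v)

  toPoly-multiple : ∀ {i d} (h : Monic i) (i≤d : i ≤ d) v → toPoly (multiple h i≤d v) ≡ toPoly h *ₚ toPoly v
  toPoly-multiple h i≤d v = trans (cong (_++ [ 1# ]) (toList-cast _ (h *ₘ v))) (sym (toPoly-*ₘ h v))

  multiples : ∀ {i} d (h : Monic i) → List (Monic d)
  multiples {i} d h with i ≤? d
  ... | yes i≤d = map (multiple h i≤d) (monics (d ∸ i))
  ... | no _    = []

  length-multiples : ∀ {i} d (h : Monic i) → i ≤ d → length (multiples d h) ≡ q ^ (d ∸ i)
  length-multiples {i} d h i≤d with i ≤? d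
  ... | yes _   = trans (length-map _ (monics (d ∸ i))) (length-monics (d ∸ i))
  ... | no i≰d  = ⊥-elim (i≰d i≤d)

  length-multiples-≤ : ∀ {i} d (h : Monic i) → length (multiples d h) ≤ q ^ (d ∸ i)
  length-multiples-≤ {i} d h with i ≤? d
  ... | yes _   = ≤-reflexive (trans (length-map _ (monics (d ∸ i))) (length-monics (d ∸ i)))
  ... | no _    = z≤n

  ∈-multiples⁻ : ∀ {i} d (h : Monic i) {f : Monic d} → f ∈ multiples d h → h ∣ₘ f
  ∈-multiples⁻ {i} d h f∈ with i ≤? d
  ... | yes i≤d with ∈-map⁻ (multiple h i≤d) f∈
  ...   | v , _ , refl = d ∸ i , v , sym (toPoly-multiple h i≤d v)

  ∈-multiples⁺ : ∀ {i} d (h : Monic i) {f : Monic d} → h ∣ₘ f → f ∈ multiples d h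
  ∈-multiples⁺ {i} d h {f} h∣f with i ≤? d | ∣ₘ⇒cofactor h f h∣f
  ... | no i≰d  | _          = ⊥-elim (i≰d (∣ₘ⇒≤ {c = h} {f} h∣f))
  ... | yes i≤d | v , hv≡f   =
    subst (_∈ map (multiple h i≤d) (monics (d ∸ i))) (toPoly-injective (trans (toPoly-multiple h i≤d v) hv≡f))
          (∈-map⁺ (multiple h i≤d) (∈-monics v))

  multiples-unique : ∀ {i} d (h : Monic i) → Unique (multiples d h)
  multiples-unique {i} d h with i ≤? d
  ... | yes i≤d = Unique.map⁺ (λ {v} {v′} hv≡hv′ →
          *ₘ-cancelˡ h (trans (sym (toPoly-multiple h i≤d v)) (trans (cong toPoly hv≡hv′) (toPoly-multiple h i≤d v′))))
        (monics-unique (d ∸ i))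
  ... | no _    = AllPairs.[]

module CommonFactors {q : ℕ} (F : FiniteField q) {e} (g : Polynomials.Monic F e) where

  open Polynomials F renaming (_+ₚ_ to infixl 6 _+ₚ_; _*ₚ_ to infixl 7 _*ₚ_; _∣ₘ_ to infix 4 _∣ₘ_)
  open MonicPolynomials F
  open Enumeration F

  common-divisor⇒InUnionB : ∀ {i d} (h : Monic i) {f : Monic d} → 1 ≤ i → h ∣ₘ g → h ∣ₘ f → InUnionB g d f
  common-divisor⇒InUnionB h {f} 1≤i h∣g h∣f with gcd g f
  ... | j , G , G∣g , G∣f , greatest =
    j , ≤-trans 1≤i (∣ₘ⇒≤ {c = h} {G} (greatest _ h h∣g h∣f)) , ∣ₘ⇒≤ {c = G} {f} G∣f , G , G∣g , G∣f , greatest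

  InUnionB⇒irreducible-common-factor : ∀ {d} {f : Monic d} → InUnionB g d f →
    Σ ℕ λ i → Σ (Monic i) λ h → IrrFactor g i h × h ∣ₘ f × i ≤ d
  InUnionB⇒irreducible-common-factor {d} {f} (j , 1≤j , j≤d , G , G∣g , G∣f , _) with irreducible-factor G 1≤j
  ... | i , h , irreducible , h∣G =
    i , h , (irreducible , ∣ₘ-trans {a = h} {G} {g} h∣G G∣g) , ∣ₘ-trans {a = h} {G} {f} h∣G G∣f ,
    ≤-trans (∣ₘ⇒≤ {c = h} {G} h∣G) j≤d

  size-of-union≥ : ∀ {k d n N} → 1 ≤ k → k ≤ d → HasCard (IrrFactor g k) n → HasCard (InUnionB g d) N →
                   n * q ^ (d ∸ k) ≤ N + (n C 2) * q ^ (d ∸ (k + k))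
  size-of-union≥ {k} {d} {n} {N} 1≤k k≤d (L , |L|≡n , !L , ∈L⇔) (U , |U|≡N , !U , ∈U⇔) = begin
    n * q ^ (d ∸ k)                                     ≡⟨ cong (_* q ^ (d ∸ k)) (sym |L|≡n) ⟩
    length L * q ^ (d ∸ k)                              ≡⟨ sym (sum-map-const (q ^ (d ∸ k)) L) ⟩
    sum (map (λ _ → q ^ (d ∸ k)) L)                     ≡⟨ sum-map-cong L (λ {h} _ → sym (length-multiples d h k≤d)) ⟩
    sum (map (λ h → length (multiples d h)) L)          ≤⟨ sum-map-mono-≤ L multiples⊆U ⟩
    sum (map (λ h → length (filter (h ∣ₘ?_) U)) L)      ≤⟨ bonferroni _∣ₘ?_ U L !L pairs≤ ⟩
    length U + (length L C 2) * q ^ (d ∸ (k + k))       ≡⟨ cong₂ (λ a b → a + (b C 2) * q ^ (d ∸ (k + k))) |U|≡N |L|≡n ⟩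
    N + (n C 2) * q ^ (d ∸ (k + k))                     ∎
    where
      open ≤-Reasoning
      factor : ∀ {h} → h ∈ L → IrrFactor g k h
      factor {h} = Equivalence.to (∈L⇔ h)

      multiples⊆U : ∀ {h} → h ∈ L → length (multiples d h) ≤ length (filter (h ∣ₘ?_) U)
      multiples⊆U {h} h∈L = Unique-⊆⇒length≤ (multiples-unique d h) λ {f} f∈ →
        let h∣f = ∈-multiples⁻ d h f∈ in
        ∈-filter⁺ (h ∣ₘ?_) (Equivalence.from (∈U⇔ f) (common-divisor⇒InUnionB h 1≤k (proj₂ (factor h∈L)) h∣f)) h∣f

      pairs≤ : PairwiseBounded _∣ₘ?_ U (q ^ (d ∸ (k + k))) L
      pairs≤ {h} {h′} h∈L h′∈L h≢h′ = ≤-trans (Unique-⊆⇒length≤ (Unique.filter⁺ _ !U) common⊆) (length-multiples-≤ d (h *ₘ h′))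
        where
          h′∤h : ¬ (h′ ∣ₘ h)
          h′∤h h′∣h = h≢h′ (sym (∣ₘ-same-degree⇒≡ {c = h′} {h} h′∣h))
          common⊆ : filter (λ x → (h ∣ₘ? x) ×-dec (h′ ∣ₘ? x)) U ⊆ multiples d (h *ₘ h′)
          common⊆ f∈ with ∈-filter⁻ (λ x → (h ∣ₘ? x) ×-dec (h′ ∣ₘ? x)) {xs = U} f∈
          ... | _ , h∣f , h′∣f = ∈-multiples⁺ d (h *ₘ h′) (irreducible-*ₘ-∣ (proj₁ (factor h′∈L)) h′∤h h∣f h′∣f)

  size-of-union≤ : ∀ {k d N} (n : ℕ → ℕ) → (∀ i → k ≤ i → i ≤ d → HasCard (IrrFactor g i) (n i)) →
                   (∀ {i} {h : Monic i} → IrrFactor g i h → k ≤ i) → HasCard (InUnionB g d) N →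
                   N ≤ sumRange k d (λ i → n i * q ^ (d ∸ i))
  size-of-union≤ {k} {d} {N} n factors k≤degree (U , |U|≡N , !U , ∈U⇔) = begin
    N                                                          ≡⟨ sym |U|≡N ⟩
    length U                                                   ≤⟨ Unique-⊆⇒length≤ !U U⊆ ⟩
    length (concat (map (factorMultiples ∘ (k +_)) (upTo (suc d ∸ k))))
                                                               ≡⟨ length-concat-map (factorMultiples ∘ (k +_)) (upTo (suc d ∸ k)) ⟩
    sum (map (length ∘ factorMultiples ∘ (k +_)) (upTo (suc d ∸ k)))
                                                               ≤⟨ sum-map-mono-≤ (upTo (suc d ∸ k)) (λ {t} _ → length-factorMultiples (k + t)) ⟩
    sumRange k d (λ i → n i * q ^ (d ∸ i))                     ∎
    where
      open ≤-Reasoning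
      factorMultiples : ℕ → List (Monic d)
      factorMultiples i with k ≤? i | i ≤? d
      ... | yes k≤i | yes i≤d = concat (map (multiples d) (proj₁ (factors i k≤i i≤d)))
      ... | _       | _       = []

      length-factorMultiples : ∀ i → length (factorMultiples i) ≤ n i * q ^ (d ∸ i)
      length-factorMultiples i with k ≤? i | i ≤? d
      ... | no _    | _       = z≤n
      ... | yes _   | no _    = z≤n
      ... | yes k≤i | yes i≤d with factors i k≤i i≤d
      ...   | L , |L|≡ni , _ = begin
        length (concat (map (multiples d) L))   ≡⟨ length-concat-map (multiples d) L ⟩
        sum (map (length ∘ multiples d) L)      ≤⟨ sum-map-mono-≤ L (λ {h} _ → length-multiples-≤ d h) ⟩
        sum (map (λ _ → q ^ (d ∸ i)) L)         ≡⟨ sum-map-const (q ^ (d ∸ i)) L ⟩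
        length L * q ^ (d ∸ i)                  ≡⟨ cong (_* q ^ (d ∸ i)) |L|≡ni ⟩
        n i * q ^ (d ∸ i)                       ∎

      ∈-factorMultiples : ∀ {i} {h : Monic i} {f : Monic d} → IrrFactor g i h → h ∣ₘ f → i ≤ d → f ∈ factorMultiples i
      ∈-factorMultiples {i} {h} factor h∣f i≤d with k ≤? i | i ≤? d
      ... | no k≰i  | _       = ⊥-elim (k≰i (k≤degree factor))
      ... | yes _   | no i≰d  = ⊥-elim (i≰d i≤d)
      ... | yes k≤i | yes i≤d′ =
        ∈-concat⁺′ (∈-multiples⁺ d h h∣f) (∈-map⁺ (multiples d) (Equivalence.from (proj₂ (proj₂ (proj₂ (factors i k≤i i≤d′))) h) factor))

      U⊆ : U ⊆ concat (map (factorMultiples ∘ (k +_)) (upTo (suc d ∸ k)))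
      U⊆ {f} f∈U with InUnionB⇒irreducible-common-factor (Equivalence.to (∈U⇔ f) f∈U)
      ... | i , h , factor , h∣f , i≤d = ∈-concat⁺′ f∈ (∈-map⁺ (factorMultiples ∘ (k +_)) (∈-upTo⁺ (∸-monoˡ-< (s≤s i≤d) k≤i)))
        where
          k≤i = k≤degree factor
          f∈ : f ∈ factorMultiples (k + (i ∸ k))
          f∈ = subst (λ j → f ∈ factorMultiples j) (sym (m+[n∸m]≡n k≤i)) (∈-factorMultiples factor h∣f i≤d)

  irreducible-factor-degree≥ : ∀ {k} (n : ℕ → ℕ) → (∀ i → 1 ≤ i → i ≤ e → HasCard (IrrFactor g i) (n i)) →
                               (∀ i → 1 ≤ i → i < k → n i ≡ 0) → ∀ {i} {h : Monic i} → IrrFactor g i h → k ≤ i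
  irreducible-factor-degree≥ {k} n counts none-below {i} {h} factor@((1≤i , _) , h∣g) with k ≤? i
  ... | yes k≤i = k≤i
  ... | no k≰i  = ⊥-elim (HasCard-0⇒∅ no-factors factor)
    where
      no-factors : HasCard (IrrFactor g i) 0
      no-factors = subst (HasCard _) (none-below i 1≤i (≰⇒> k≰i)) (counts i 1≤i (∣ₘ⇒≤ {c = h} {g} h∣g))

proposition4p1 : (q : ℕ) (F : FiniteField q) (e d : ℕ) → 0 < d → d < e →
  (g : Polynomials.Monic F e) →
  (λ* : ℕ → ℕ) →
  (∀ i → 1 ≤ i → i ≤ e → HasCard (Polynomials.IrrFactor F g i) (λ* i)) →
  (k : ℕ) → 1 ≤ k → 0 < λ* k → (∀ i → 1 ≤ i → i < k → λ* i ≡ 0) →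
  (N : ℕ) → HasCard (Polynomials.InUnionB F g d) N →
  k ≤ d →
  (λ* k * q ^ (d ∸ k) ≤ N + (λ* k C 2) * q ^ (d ∸ (k + k)))
  × (N ≤ λ* k * q ^ (d ∸ k) + sumRange (k + 1) d (λ i → λ* i * q ^ (d ∸ i)))
proposition4p1 q F e d _ d<e g λ* counts k 1≤k _ none-below N union k≤d =
    size-of-union≥ 1≤k k≤d (counts k 1≤k (≤-trans k≤d d≤e)) union
  , subst (N ≤_) (sumRange-unfoldˡ (λ i → λ* i * q ^ (d ∸ i)) k≤d)
      (size-of-union≤ λ* (λ i k≤i i≤d → counts i (≤-trans 1≤k k≤i) (≤-trans i≤d d≤e))
                      (irreducible-factor-degree≥ λ* counts none-below) union)
  where
    open CommonFactors F g
    d≤e = <⇒≤ d<e
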